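{- For every integer $\Delta\ge 0$, $\operatorname{bx}(\Delta) \leq \dim(\Delta+1)$.
   Context: For a finite graph $G$, the boxicity $\operatorname{bx}(G)$ is the minimum $d$ such that there are boxes (Cartesian products of $d$ intervals of $\mathbb{R}$) $B_v$, $v\in V(G)$, with $B_v\cap B_w\ne\emptyset$ iff $vw\in E(G)$ for distinct $v,w$. $\operatorname{bx}(\Delta)$ denotes the maximum boxicity of a finite graph with maximum degree at most $\Delta$. The dimension of a finite poset is the minimum number of total orders whose intersection is the poset; $\dim(\Delta)$ denotes the maximum dimension of a finite poset whose comparability graph (elements as vertices, distinct comparable elements adjacent) has maximum degree at most $\Delta$. -}

module Defs where

open import Data.Nat using (ℕ; zero; suc; _+_; _≤_)
open import Data.Fin using (Fin; zero; suc; _≟_)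
open import Data.Bool using (Bool; true; false; _∧_; _∨_; not; if_then_else_)
open import Data.Sum using (_⊎_)
open import Data.Product using (Σ; _×_; _,_)
open import Data.Rational using (ℚ) renaming (_≤_ to _≤ℚ_)
open import Relation.Binary.PropositionalEquality using (_≡_; _≢_)
open import Relation.Nullary using (does)
open import Function.Bundles using (_⇔_)

count : ∀ {n} → (Fin n → Bool) → ℕ
count {zero} p = 0
count {suc n} p = (if p zero then 1 else 0) + count (λ i → p (suc i))

record Graph (n : ℕ) : Set where
  field
    adj     : Fin n → Fin n → Bool
    sym     : ∀ v w → adj v w ≡ adj w v
    irrefl  : ∀ v → adj v v ≡ false

open Graph public

degree : ∀ {n} → Graph n → Fin n → ℕ
degree G v = count (adj G v)

MaxDegree≤ : ∀ {n} → Graph n → ℕ → Set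
MaxDegree≤ G Δ = ∀ v → degree G v ≤ Δ

-- A d-dimensional box representation: vertex v gets the box
-- ∏_{i<d} [lo v i , hi v i] (closed, nonempty intervals, rational endpoints);
-- distinct v, w are adjacent iff their boxes intersect.
record BoxRep {n} (G : Graph n) (d : ℕ) : Set where
  field
    lo hi   : Fin n → Fin d → ℚ
    nonempty : ∀ v i → lo v i ≤ℚ hi v i
    correct  : ∀ v w → v ≢ w →
               (adj G v w ≡ true) ⇔
               (∀ i → (lo v i ≤ℚ hi w i) × (lo w i ≤ℚ hi v i))

Boxicity≤ : ∀ {n} → Graph n → ℕ → Set
Boxicity≤ G d = BoxRep G d

record Poset (n : ℕ) : Set where
  field
    le      : Fin n → Fin n → Bool
    refl    : ∀ x → le x x ≡ true
    antisym : ∀ x y → le x y ≡ true → le y x ≡ true → x ≡ y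
    trans   : ∀ x y z → le x y ≡ true → le y z ≡ true → le x z ≡ true

open Poset public

record TotalOrder (n : ℕ) : Set where
  field
    poset : Poset n
    total : ∀ x y → (le poset x y ≡ true) ⊎ (le poset y x ≡ true)

compDegree : ∀ {n} → Poset n → Fin n → ℕ
compDegree P x = count (λ y → (le P x y ∨ le P y x) ∧ not (does (x ≟ y)))

MaxCompDegree≤ : ∀ {n} → Poset n → ℕ → Set
MaxCompDegree≤ P Δ = ∀ x → compDegree P x ≤ Δ

Dimension≤ : ∀ {n} → Poset n → ℕ → Set
Dimension≤ {n} P d =
  Σ (Fin d → TotalOrder n) λ L →
    ∀ x y → (le P x y ≡ true) ⇔ (∀ i → le (TotalOrder.poset (L i)) x y ≡ true)

-- Give each vertex v a lower copy v⁻ and an upper copy v⁺, with v⁻ < w⁺ exactly when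
-- v = w or vw is an edge. This height-two poset has comparability degree at most Δ + 1,
-- so it is the intersection of d linear orders L₁, …, L_d. The box of v has i-th side
-- [rank of v⁻ in Lᵢ, rank of v⁺ in Lᵢ]; the boxes of v and w meet in every coordinate
-- iff v⁻ ≤ w⁺ and w⁻ ≤ v⁺ in every Lᵢ, i.e. iff v and w are adjacent.
module Submission where

open import Defs hiding (refl; sym; trans)
open import Data.Bool using (Bool; true; false; _∨_; if_then_else_)
open import Data.Bool.Properties using (∧-conicalˡ; ∧-conicalʳ; ∨-identityʳ)
open import Data.Fin using (Fin; zero; suc; _≟_; _↑ˡ_; _↑ʳ_; splitAt; join)
open import Data.Fin.Properties using (splitAt-↑ˡ; splitAt-↑ʳ; join-splitAt)
import Data.Integer as ℤ
open import Data.Integer.Properties using (*-identityʳ; drop‿+≤+)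
open import Data.Nat using (ℕ; zero; suc; _+_; _≤_; _<_; z≤n; s≤s)
open import Data.Nat.Properties
  using ( ≤-refl; ≤-reflexive; ≤-trans; <⇒≱; +-assoc; +-identityʳ
        ; +-mono-≤; +-mono-<-≤; +-mono-≤-<; +-commutativeSemigroup)
open import Algebra.Properties.CommutativeSemigroup +-commutativeSemigroup using (interchange)
open import Data.Product using (_,_; proj₁)
open import Data.Rational using (ℚ; *≤*) renaming (_≤_ to _≤ℚ_)
open import Data.Rational.Literals using (fromℤ)
open import Data.Sum using (_⊎_; inj₁; inj₂; [_,_]; map₁)
open import Function using (id; _∘_)
open import Function.Bundles using (_⇔_; mk⇔; Equivalence)
open import Relation.Binary.PropositionalEquality
  using (_≡_; _≢_; refl; sym; trans; cong; cong₂; subst; subst₂)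
open import Relation.Nullary using (Dec; yes; does; ¬?; _⊎-dec_; contradiction)
open import Relation.Nullary.Decidable using (dec-true; dec-false; does-⇔)

does-true⇒ : ∀ {a} {A : Set a} (a? : Dec A) → does a? ≡ true → A
does-true⇒ (yes a) _ = a

splitAt-injective : ∀ n {m} {x y : Fin (n + m)} → splitAt n x ≡ splitAt n y → x ≡ y
splitAt-injective n {m} {x} {y} eq =
  trans (sym (join-splitAt n m x)) (trans (cong (join n m) eq) (join-splitAt n m y))

either-≟⇒≡ : ∀ {k} {i j : Fin k} → (does (i ≟ j) ∨ does (j ≟ i)) ≡ true → i ≡ j
either-≟⇒≡ {i = i} {j} h = [ id , sym ] (does-true⇒ ((i ≟ j) ⊎-dec (j ≟ i)) h)

indicator : Bool → ℕ
indicator b = if b then 1 else 0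

indicator-mono : ∀ {a b} → (a ≡ true → b ≡ true) → indicator a ≤ indicator b
indicator-mono {false} _ = z≤n
indicator-mono {true} a⇒b rewrite a⇒b refl = s≤s z≤n

indicator-∨ : ∀ a b → indicator (a ∨ b) ≤ indicator a + indicator b
indicator-∨ false b = ≤-refl
indicator-∨ true b = s≤s z≤n

count-false : ∀ n → count {n} (λ _ → false) ≡ 0
count-false zero = refl
count-false (suc n) = count-false n

count-mono : ∀ {n} {p q : Fin n → Bool} → (∀ i → p i ≡ true → q i ≡ true) → count p ≤ count q
count-mono {zero} _ = z≤n
count-mono {suc n} p⊆q = +-mono-≤ (indicator-mono (p⊆q zero)) (count-mono (p⊆q ∘ suc))

count-mono-< : ∀ {n} {p q : Fin n → Bool} → (∀ i → p i ≡ true → q i ≡ true) →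
               ∀ a → p a ≡ false → q a ≡ true → count p < count q
count-mono-< {suc n} p⊆q zero pa qa rewrite pa | qa =
  +-mono-<-≤ (s≤s z≤n) (count-mono (p⊆q ∘ suc))
count-mono-< {suc n} p⊆q (suc a) pa qa =
  +-mono-≤-< (indicator-mono (p⊆q zero)) (count-mono-< (p⊆q ∘ suc) a pa qa)

count-∨ : ∀ {n} (p q : Fin n → Bool) → count (λ i → p i ∨ q i) ≤ count p + count q
count-∨ {zero} p q = z≤n
count-∨ {suc n} p q =
  ≤-trans (+-mono-≤ (indicator-∨ (p zero) (q zero)) (count-∨ (p ∘ suc) (q ∘ suc)))
          (≤-reflexive (interchange (indicator (p zero)) (indicator (q zero)) _ _))

count-≟ : ∀ {n} (i : Fin n) → count (λ j → does (i ≟ j)) ≡ 1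
count-≟ {suc n} zero = cong suc (count-false n)
count-≟ (suc i) = count-≟ i

count-splitAt : ∀ n {m} (f : Fin n ⊎ Fin m → Bool) →
                count (f ∘ splitAt n) ≡ count (f ∘ inj₁) + count (f ∘ inj₂)
count-splitAt zero f = refl
count-splitAt (suc n) f =
  trans (cong (indicator (f (inj₁ zero)) +_) (count-splitAt n (f ∘ map₁ suc)))
        (sym (+-assoc (indicator (f (inj₁ zero))) _ _))

module _ {n : ℕ} (T : TotalOrder n) where
  open TotalOrder T

  rank : Fin n → ℕ
  rank x = count (λ z → le poset z x)

  rank-mono : ∀ {x y} → le poset x y ≡ true → rank x ≤ rank y
  rank-mono {x} {y} x≤y = count-mono (λ z z≤x → Poset.trans poset z x y z≤x x≤y)

  rank-cancel : ∀ {x y} → rank x ≤ rank y → le poset x y ≡ true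
  rank-cancel {x} {y} rx≤ry with le poset x y in x≰y | total x y
  ... | true  | _ = refl
  ... | false | inj₁ ()
  ... | false | inj₂ y≤x =
    contradiction rx≤ry
      (<⇒≱ (count-mono-< (λ z z≤y → Poset.trans poset z y x z≤y y≤x) x x≰y (Poset.refl poset x)))

ℕ→ℚ : ℕ → ℚ
ℕ→ℚ n = fromℤ (ℤ.+ n)

ℕ→ℚ-mono : ∀ {m n} → m ≤ n → ℕ→ℚ m ≤ℚ ℕ→ℚ n
ℕ→ℚ-mono {m} {n} m≤n =
  *≤* (subst₂ ℤ._≤_ (sym (*-identityʳ (ℤ.+ m))) (sym (*-identityʳ (ℤ.+ n))) (ℤ.+≤+ m≤n))

ℕ→ℚ-cancel : ∀ {m n} → ℕ→ℚ m ≤ℚ ℕ→ℚ n → m ≤ n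
ℕ→ℚ-cancel {m} {n} (*≤* m≤n) =
  drop‿+≤+ (subst₂ ℤ._≤_ (*-identityʳ (ℤ.+ m)) (*-identityʳ (ℤ.+ n)) m≤n)

Realizes : ∀ {k d} → Poset k → (Fin d → TotalOrder k) → Set
Realizes P L = ∀ x y → (le P x y ≡ true) ⇔ (∀ i → le (TotalOrder.poset (L i)) x y ≡ true)

coordinate : ∀ {k d} → (Fin d → TotalOrder k) → Fin d → Fin k → ℚ
coordinate L i x = ℕ→ℚ (rank (L i) x)

realizer-embedding : ∀ {k d} (P : Poset k) (L : Fin d → TotalOrder k) → Realizes P L →
                     ∀ x y → (le P x y ≡ true) ⇔ (∀ i → coordinate L i x ≤ℚ coordinate L i y)
realizer-embedding P L realizes x y = mk⇔
  (λ x≤y i → ℕ→ℚ-mono (rank-mono (L i) (Equivalence.to (realizes x y) x≤y i)))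
  (λ x≤y → Equivalence.from (realizes x y) (λ i → rank-cancel (L i) (ℕ→ℚ-cancel (x≤y i))))

module Bipartite {n m : ℕ} (R : Fin n → Fin m → Bool) where

  _≼_ : Fin n ⊎ Fin m → Fin n ⊎ Fin m → Bool
  inj₁ a ≼ inj₁ a′ = does (a ≟ a′)
  inj₁ a ≼ inj₂ b  = R a b
  inj₂ b ≼ inj₁ a  = false
  inj₂ b ≼ inj₂ b′ = does (b ≟ b′)

  ≼-refl : ∀ s → (s ≼ s) ≡ true
  ≼-refl (inj₁ a) = dec-true (a ≟ a) refl
  ≼-refl (inj₂ b) = dec-true (b ≟ b) refl

  ≼-antisym : ∀ s t → (s ≼ t) ≡ true → (t ≼ s) ≡ true → s ≡ t
  ≼-antisym (inj₁ a) (inj₁ a′) a≡a′ _ = cong inj₁ (does-true⇒ (a ≟ a′) a≡a′)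
  ≼-antisym (inj₂ b) (inj₂ b′) b≡b′ _ = cong inj₂ (does-true⇒ (b ≟ b′) b≡b′)

  ≼-trans : ∀ s t u → (s ≼ t) ≡ true → (t ≼ u) ≡ true → (s ≼ u) ≡ true
  ≼-trans (inj₁ a) (inj₁ b) u       a≡b b≼u rewrite does-true⇒ (a ≟ b) a≡b = b≼u
  ≼-trans (inj₁ a) (inj₂ b) (inj₂ c) Rab b≡c rewrite sym (does-true⇒ (b ≟ c) b≡c) = Rab
  ≼-trans (inj₂ a) (inj₂ b) u       a≡b b≼u rewrite does-true⇒ (a ≟ b) a≡b = b≼u

  bipartitePoset : Poset (n + m)
  bipartitePoset = record
    { le      = λ x y → splitAt n x ≼ splitAt n y
    ; refl    = λ x → ≼-refl (splitAt n x)
    ; antisym = λ x y x≤y y≤x → splitAt-injective n (≼-antisym (splitAt n x) (splitAt n y) x≤y y≤x)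
    ; trans   = λ x y z → ≼-trans (splitAt n x) (splitAt n y) (splitAt n z)
    }

  bipartitePoset-low≤high : ∀ a b → le bipartitePoset (a ↑ˡ m) (n ↑ʳ b) ≡ R a b
  bipartitePoset-low≤high a b = cong₂ _≼_ (splitAt-↑ˡ n a m) (splitAt-↑ʳ n m b)

  crosses : Fin n ⊎ Fin m → Fin n ⊎ Fin m → Bool
  crosses (inj₁ _) (inj₁ _) = false
  crosses (inj₁ a) (inj₂ b) = R a b
  crosses (inj₂ b) (inj₁ a) = R a b
  crosses (inj₂ _) (inj₂ _) = false

  comparable⇒crosses : ∀ s t → s ≢ t → ((s ≼ t) ∨ (t ≼ s)) ≡ true → crosses s t ≡ true
  comparable⇒crosses (inj₁ a) (inj₁ a′) s≢t h = contradiction (cong inj₁ (either-≟⇒≡ h)) s≢t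
  comparable⇒crosses (inj₁ a) (inj₂ b) _ h = trans (sym (∨-identityʳ (R a b))) h
  comparable⇒crosses (inj₂ b) (inj₁ a) _ h = h
  comparable⇒crosses (inj₂ b) (inj₂ b′) s≢t h = contradiction (cong inj₂ (either-≟⇒≡ h)) s≢t

  compDegree≤crosses : ∀ x →
                       compDegree bipartitePoset x ≤ count (crosses (splitAt n x) ∘ splitAt n)
  compDegree≤crosses x = count-mono λ y h →
    comparable⇒crosses (splitAt n x) (splitAt n y)
      (does-true⇒ (¬? (x ≟ y)) (∧-conicalʳ _ _ h) ∘ splitAt-injective n)
      (∧-conicalˡ _ _ h)

  bipartitePoset-maxCompDegree : ∀ {k} → (∀ a → count (R a) ≤ k) →
                                 (∀ b → count (λ a → R a b) ≤ k) →
                                 MaxCompDegree≤ bipartitePoset k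
  bipartitePoset-maxCompDegree {k} low high x =
    ≤-trans (compDegree≤crosses x)
            (≤-trans (≤-reflexive (count-splitAt n (crosses (splitAt n x)))) (crossings≤ (splitAt n x)))
    where
      crossings≤ : ∀ s → count (crosses s ∘ inj₁) + count (crosses s ∘ inj₂) ≤ k
      crossings≤ (inj₁ a) = ≤-trans (≤-reflexive (cong (_+ count (R a)) (count-false n))) (low a)
      crossings≤ (inj₂ b) =
        ≤-trans (≤-reflexive (trans (cong (count (λ a → R a b) +_) (count-false m)) (+-identityʳ _)))
                (high b)

open Bipartite using (bipartitePoset; bipartitePoset-low≤high; bipartitePoset-maxCompDegree)

module _ {n : ℕ} (G : Graph n) where

  closedAdj : Fin n → Fin n → Bool
  closedAdj v w = does (v ≟ w) ∨ adj G v w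

  closedAdj-refl : ∀ v → closedAdj v v ≡ true
  closedAdj-refl v rewrite dec-true (v ≟ v) refl = refl

  closedAdj-sym : ∀ v w → closedAdj v w ≡ closedAdj w v
  closedAdj-sym v w = cong₂ _∨_ (does-⇔ (mk⇔ sym sym) (v ≟ w) (w ≟ v)) (Graph.sym G v w)

  closedAdj-≢ : ∀ {v w} → v ≢ w → closedAdj v w ≡ adj G v w
  closedAdj-≢ {v} {w} v≢w = cong (_∨ adj G v w) (dec-false (v ≟ w) v≢w)

  count-closedAdj : ∀ v → count (closedAdj v) ≤ suc (degree G v)
  count-closedAdj v = ≤-trans (count-∨ (λ w → does (v ≟ w)) (adj G v))
                              (≤-reflexive (cong (_+ degree G v) (count-≟ v)))

  closedNeighbourhoodPoset : Poset (n + n)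
  closedNeighbourhoodPoset = bipartitePoset closedAdj

  closedNeighbourhoodPoset-maxCompDegree : ∀ {Δ} → MaxDegree≤ G Δ →
                                           MaxCompDegree≤ closedNeighbourhoodPoset (suc Δ)
  closedNeighbourhoodPoset-maxCompDegree maxDegree =
    bipartitePoset-maxCompDegree closedAdj
      (λ v → ≤-trans (count-closedAdj v) (s≤s (maxDegree v)))
      (λ w → ≤-trans (count-mono (λ v w∈N[v] → trans (closedAdj-sym w v) w∈N[v]))
                     (≤-trans (count-closedAdj w) (s≤s (maxDegree w))))

  realizer⇒boxRep : ∀ {d} (L : Fin d → TotalOrder (n + n)) →
                    Realizes closedNeighbourhoodPoset L → BoxRep G d
  realizer⇒boxRep {d} L realizes = record
    { lo       = lo
    ; hi       = hi
    ; nonempty = λ v → Equivalence.to (closedAdj⇔lo≤hi v v) (closedAdj-refl v)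
    ; correct  = λ v w v≢w → mk⇔
        (λ vw → let vw′ = trans (closedAdj-≢ v≢w) vw in
          λ i → Equivalence.to (closedAdj⇔lo≤hi v w) vw′ i
              , Equivalence.to (closedAdj⇔lo≤hi w v) (trans (closedAdj-sym w v) vw′) i)
        (λ boxesMeet → trans (sym (closedAdj-≢ v≢w))
                             (Equivalence.from (closedAdj⇔lo≤hi v w) (proj₁ ∘ boxesMeet)))
    }
    where
      lo hi : Fin n → Fin d → ℚ
      lo v i = coordinate L i (v ↑ˡ n)
      hi v i = coordinate L i (n ↑ʳ v)

      closedAdj⇔lo≤hi : ∀ v w → (closedAdj v w ≡ true) ⇔ (∀ i → lo v i ≤ℚ hi w i)
      closedAdj⇔lo≤hi v w = subst (λ b → (b ≡ true) ⇔ (∀ i → lo v i ≤ℚ hi w i))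
        (bipartitePoset-low≤high closedAdj v w)
        (realizer-embedding closedNeighbourhoodPoset L realizes (v ↑ˡ n) (n ↑ʳ w))

proposition2p8 : (Δ d : ℕ) →
    (∀ (m : ℕ) (P : Poset m) → MaxCompDegree≤ P (suc Δ) → Dimension≤ P d) →
    ∀ (n : ℕ) (G : Graph n) → MaxDegree≤ G Δ → Boxicity≤ G d
proposition2p8 Δ d dim≤ n G maxDegree =
  let (L , realizes) = dim≤ (n + n) (closedNeighbourhoodPoset G)
                              (closedNeighbourhoodPoset-maxCompDegree G maxDegree)
  in realizer⇒boxRep G L realizes
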